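{- Every $B_1$-free split graph has VC-dimension at most $3$, i.e., its neighbourhood hypergraph has VC-dimension at most $3$.
   Context: A split graph has vertex set partitioned into a clique $K$ and a stable set $S$. $B_1$ is the graph on six vertices consisting of a triangle $p,q,r$ together with three further vertices $p',q',r'$ and the edges $pp',qq',rr'$ (each triangle vertex has one pendant neighbour). A graph is $B_1$-free if it has no induced subgraph isomorphic to $B_1$. The VC-dimension of $G=(V,E)$ is the largest $d$ such that some $X\subseteq V$ with $|X|=d$ is shattered, i.e., for every $Y\subseteq X$ there is $z\in V$ with $N[z]\cap X=Y$ ($N[z]$ the closed neighbourhood). -}

module Defs where

open import Data.Nat using (ℕ; _≤_)
open import Data.Fin using (Fin; zero; suc)
open import Data.Bool using (Bool; true; false)
open import Data.Product using (_×_; ∃-syntax; Σ-syntax)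
open import Data.Sum using (_⊎_)
open import Data.Unit using (⊤)
open import Data.Empty using (⊥)
open import Relation.Nullary using (¬_; Dec)
open import Relation.Binary.PropositionalEquality using (_≡_; _≢_)
open import Function.Definitions using (Injective)
open import Function.Bundles using (_⇔_)

record Graph (n : ℕ) : Set₁ where
  field
    Adj    : Fin n → Fin n → Set
    sym    : ∀ {u v} → Adj u v → Adj v u
    irrefl : ∀ {v} → ¬ Adj v v
    dec    : ∀ u v → Dec (Adj u v)
open Graph public

-- Split graph: vertex set partitioned (by the indicator inK) into a clique K
-- (inK = true) and a stable set S (inK = false).
IsSplit : ∀ {n} → Graph n → Set
IsSplit {n} G =
  Σ[ inK ∈ (Fin n → Bool) ] ((∀ (u v : Fin n) → u ≢ v → inK u ≡ true → inK v ≡ true → Adj G u v)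
          × (∀ (u v : Fin n) → inK u ≡ false → inK v ≡ false → ¬ Adj G u v))

-- Edges of B₁ on vertices 0..5: triangle p=0,q=1,r=2; pendants p'=3,q'=4,r'=5.
B₁Edge₀ : Fin 6 → Fin 6 → Set
B₁Edge₀ zero (suc zero) = ⊤
B₁Edge₀ zero (suc (suc zero)) = ⊤
B₁Edge₀ (suc zero) (suc (suc zero)) = ⊤
B₁Edge₀ zero (suc (suc (suc zero))) = ⊤
B₁Edge₀ (suc zero) (suc (suc (suc (suc zero)))) = ⊤
B₁Edge₀ (suc (suc zero)) (suc (suc (suc (suc (suc zero))))) = ⊤
B₁Edge₀ _ _ = ⊥

B₁Edge : Fin 6 → Fin 6 → Set
B₁Edge i j = B₁Edge₀ i j ⊎ B₁Edge₀ j i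

HasInducedB₁ : ∀ {n} → Graph n → Set
HasInducedB₁ {n} G =
  ∃[ f ] (Injective {A = Fin 6} {B = Fin n} _≡_ _≡_ f ×
          (∀ (i j : Fin 6) → i ≢ j → (Adj G (f i) (f j) ⇔ B₁Edge i j)))

B₁Free : ∀ {n} → Graph n → Set
B₁Free G = ¬ HasInducedB₁ G

InClosedNbhd : ∀ {n} → Graph n → Fin n → Fin n → Set
InClosedNbhd G z v = (v ≡ z) ⊎ Adj G z v

-- X = {x 0, …, x (d-1)} (x injective) is shattered: for every Y ⊆ X
-- (given by its indicator Y : Fin d → Bool) there is z with N[z] ∩ X = Y.
Shattered : ∀ {n d} → Graph n → (Fin d → Fin n) → Set
Shattered {n} {d} G x =
  Injective _≡_ _≡_ x ×
  (∀ (Y : Fin d → Bool) → ∃[ z ] (∀ (i : Fin d) → (InClosedNbhd G z (x i) ⇔ (Y i ≡ true))))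

VCDimAtMost : ∀ {n} → Graph n → ℕ → Set
VCDimAtMost {n} G k = ∀ (d : ℕ) (x : Fin d → Fin n) → Shattered G x → d ≤ k

-- In a split graph with clique K and stable set S, a vertex z whose closed neighbourhood contains
-- two vertices of S lies in K, and then N[z] contains every vertex of K. Hence a shattered set that
-- meets K meets S in at most one vertex, so a shattered 4-set lies in S or has three vertices in K.
-- Three shattered vertices a, b, c of K are cut out singly by vertices z_a, z_b, z_c, which miss
-- the other two and so lie in S: a triangle with pendants. Four shattered vertices a, b, c, e of S
-- give pendants a, b, c to the triangle of vertices of K cutting out {a, e}, {b, e}, {c, e}.
-- Either way B₁ is induced.
module Submission where

open import Data.Bool using (Bool; true; false) renaming (_≟_ to _≟ᵇ_)
open import Data.Bool.Properties using (T-≡; ¬-not)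
open import Data.Empty using (⊥; ⊥-elim)
open import Data.Fin using (Fin; zero; suc; _≟_; punchIn; inject≤; splitAt; join)
open import Data.Fin.Patterns using (0F; 1F; 2F; 3F; 4F; 5F)
open import Data.Fin.Properties using (punchIn-injective; punchInᵢ≢i; inject≤-injective; join-splitAt; all?; any?; ¬∀⟶∃¬)
open import Data.Nat as ℕ using (ℕ; _≤?_)
open import Data.Nat.Properties using (≰⇒>)
open import Data.Product using (∃-syntax; _,_; proj₁; proj₂)
open import Data.Sum using (_⊎_; inj₁; inj₂; [_,_]; [_,_]′)
open import Data.Unit using (tt)
open import Function using (_∘_; const)
open import Function.Bundles using (_⇔_; mk⇔; Equivalence)
open import Function.Definitions using (Injective)
import Function.Properties.Equivalence as ⇔
open import Relation.Nullary using (¬_; yes; no; contradiction)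
open import Relation.Nullary.Decidable using (isYes; toWitness; fromWitness; _⊎-dec_)
open import Relation.Unary using (Decidable)
open import Relation.Binary.PropositionalEquality using (_≡_; _≢_; refl; trans; cong; subst; ≢-sym; module ≡-Reasoning) renaming (sym to ≡-sym)
open import Defs

open Equivalence using (to; from)

record PendantTriangle {n} (G : Graph n) : Set where
  field
    apex pendant    : Fin 3 → Fin n
    apex-adj        : ∀ {i j} → i ≢ j → Adj G (apex i) (apex j)
    pendant-nonadj  : ∀ i j → ¬ Adj G (pendant i) (pendant j)
    apex-pendant    : ∀ i → Adj G (apex i) (pendant i)
    apex-nonpendant : ∀ {i j} → i ≢ j → ¬ Adj G (apex i) (pendant j)

pendantTriangle⇒B₁ : ∀ {n} {G : Graph n} → PendantTriangle G → HasInducedB₁ G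
pendantTriangle⇒B₁ {n} {G} T = f , f-injective , adjacency
  where
  open PendantTriangle T

  vertex : Fin 3 ⊎ Fin 3 → Fin n
  vertex = [ apex , pendant ]′

  f : Fin 6 → Fin n
  f = vertex ∘ splitAt 3

  vertex-injective : Injective _≡_ _≡_ vertex
  vertex-injective {inj₁ i} {inj₁ j} eq with i ≟ j
  ... | yes i≡j = cong inj₁ i≡j
  ... | no i≢j = contradiction (subst (λ v → Adj G v (apex j)) eq (apex-adj i≢j)) (irrefl G)
  vertex-injective {inj₂ i} {inj₂ j} eq with i ≟ j
  ... | yes i≡j = cong inj₂ i≡j
  ... | no i≢j = contradiction (subst (Adj G (apex i)) eq (apex-pendant i)) (apex-nonpendant i≢j)
  vertex-injective {inj₁ i} {inj₂ j} eq =
    contradiction (subst (λ v → Adj G v (pendant i)) eq (apex-pendant i)) (pendant-nonadj j i)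
  vertex-injective {inj₂ i} {inj₁ j} eq =
    contradiction (subst (λ v → Adj G v (pendant j)) (≡-sym eq) (apex-pendant j)) (pendant-nonadj i j)

  f-injective : Injective _≡_ _≡_ f
  f-injective {i} {j} eq = begin
    i                       ≡⟨ join-splitAt 3 3 i ⟨
    join 3 3 (splitAt 3 i)  ≡⟨ cong (join 3 3) (vertex-injective {splitAt 3 i} {splitAt 3 j} eq) ⟩
    join 3 3 (splitAt 3 j)  ≡⟨ join-splitAt 3 3 j ⟩
    j                       ∎
    where open ≡-Reasoning

  edge : ∀ {u v} {E : Set} → Adj G u v → E → Adj G u v ⇔ E
  edge uv e = mk⇔ (const e) (const uv)

  nonEdge : ∀ {u v} {E : Set} → ¬ Adj G u v → ¬ E → Adj G u v ⇔ E
  nonEdge ¬uv ¬e = mk⇔ (⊥-elim ∘ ¬uv) (⊥-elim ∘ ¬e)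

  noB₁Edge : ¬ (⊥ ⊎ ⊥)
  noB₁Edge = [ (λ ()) , (λ ()) ]

  adjacency : ∀ i j → i ≢ j → Adj G (f i) (f j) ⇔ B₁Edge i j
  adjacency 0F 0F i≢i = contradiction refl i≢i
  adjacency 0F 1F _ = edge (apex-adj λ ()) (inj₁ tt)
  adjacency 0F 2F _ = edge (apex-adj λ ()) (inj₁ tt)
  adjacency 0F 3F _ = edge (apex-pendant 0F) (inj₁ tt)
  adjacency 0F 4F _ = nonEdge (apex-nonpendant λ ()) noB₁Edge
  adjacency 0F 5F _ = nonEdge (apex-nonpendant λ ()) noB₁Edge
  adjacency 1F 0F _ = edge (apex-adj λ ()) (inj₂ tt)
  adjacency 1F 1F i≢i = contradiction refl i≢i
  adjacency 1F 2F _ = edge (apex-adj λ ()) (inj₁ tt)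
  adjacency 1F 3F _ = nonEdge (apex-nonpendant λ ()) noB₁Edge
  adjacency 1F 4F _ = edge (apex-pendant 1F) (inj₁ tt)
  adjacency 1F 5F _ = nonEdge (apex-nonpendant λ ()) noB₁Edge
  adjacency 2F 0F _ = edge (apex-adj λ ()) (inj₂ tt)
  adjacency 2F 1F _ = edge (apex-adj λ ()) (inj₂ tt)
  adjacency 2F 2F i≢i = contradiction refl i≢i
  adjacency 2F 3F _ = nonEdge (apex-nonpendant λ ()) noB₁Edge
  adjacency 2F 4F _ = nonEdge (apex-nonpendant λ ()) noB₁Edge
  adjacency 2F 5F _ = edge (apex-pendant 2F) (inj₁ tt)
  adjacency 3F 0F _ = edge (sym G (apex-pendant 0F)) (inj₂ tt)
  adjacency 3F 1F _ = nonEdge (apex-nonpendant (λ ()) ∘ sym G) noB₁Edge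
  adjacency 3F 2F _ = nonEdge (apex-nonpendant (λ ()) ∘ sym G) noB₁Edge
  adjacency 4F 0F _ = nonEdge (apex-nonpendant (λ ()) ∘ sym G) noB₁Edge
  adjacency 4F 1F _ = edge (sym G (apex-pendant 1F)) (inj₂ tt)
  adjacency 4F 2F _ = nonEdge (apex-nonpendant (λ ()) ∘ sym G) noB₁Edge
  adjacency 5F 0F _ = nonEdge (apex-nonpendant (λ ()) ∘ sym G) noB₁Edge
  adjacency 5F 1F _ = nonEdge (apex-nonpendant (λ ()) ∘ sym G) noB₁Edge
  adjacency 5F 2F _ = edge (sym G (apex-pendant 2F)) (inj₂ tt)
  adjacency (suc (suc (suc i))) (suc (suc (suc j))) _ = nonEdge (pendant-nonadj i j) noB₁Edge

atMostOneFalse⇒allTrueExcept : ∀ {m} (σ : Fin (ℕ.suc m) → Bool) →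
                               (∀ {s t} → σ s ≡ false → σ t ≡ false → s ≡ t) →
                               ∃[ k ] (∀ i → i ≢ k → σ i ≡ true)
atMostOneFalse⇒allTrueExcept σ unique with any? (λ i → σ i ≟ᵇ false)
... | yes (s , σs≡false) = s , λ i i≢s → ¬-not (i≢s ∘ λ σi≡false → unique σi≡false σs≡false)
... | no no-false = zero , λ i _ → ¬-not (no-false ∘ (i ,_))

module SplitGraph {n} (G : Graph n) (inK : Fin n → Bool)
  (K-clique : ∀ u v → u ≢ v → inK u ≡ true → inK v ≡ true → Adj G u v)
  (S-stable : ∀ u v → inK u ≡ false → inK v ≡ false → ¬ Adj G u v) where

  S≢K : ∀ {u v} → inK u ≡ false → inK v ≡ true → inK u ≢ inK v
  S≢K u∈S v∈K eq = contradiction (trans (≡-sym u∈S) (trans eq v∈K)) λ ()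

  K-closedNbhd : ∀ {z v} → inK z ≡ true → inK v ≡ true → InClosedNbhd G z v
  K-closedNbhd {z} {v} z∈K v∈K with v ≟ z
  ... | yes v≡z = inj₁ v≡z
  ... | no v≢z = inj₂ (K-clique z v (≢-sym v≢z) z∈K v∈K)

  closedNbhd⇒Adj : ∀ {z v} → inK z ≢ inK v → InClosedNbhd G z v → Adj G z v
  closedNbhd⇒Adj sides (inj₁ v≡z) = contradiction (cong inK (≡-sym v≡z)) sides
  closedNbhd⇒Adj _ (inj₂ zv) = zv

  closedNbhd-missing-K⇒S : ∀ {z v} → inK v ≡ true → ¬ InClosedNbhd G z v → inK z ≡ false
  closedNbhd-missing-K⇒S {z} v∈K v∉N[z] with inK z in z-side
  ... | false = refl
  ... | true = contradiction (K-closedNbhd z-side v∈K) v∉N[z]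

  closedNbhd-two-S⇒K : ∀ {z u v} → u ≢ v → inK u ≡ false → inK v ≡ false →
                        InClosedNbhd G z u → InClosedNbhd G z v → inK z ≡ true
  closedNbhd-two-S⇒K {z} u≢v u∈S v∈S u∈N[z] v∈N[z] with inK z in z-side
  ... | true = refl
  ... | false = contradiction (trans (self u∈S u∈N[z]) (≡-sym (self v∈S v∈N[z]))) u≢v
    where
    self : ∀ {w} → inK w ≡ false → InClosedNbhd G z w → w ≡ z
    self _ (inj₁ w≡z) = w≡z
    self w∈S (inj₂ zw) = contradiction zw (S-stable _ _ z-side w∈S)

  module Shattering {d} {x : Fin d → Fin n} (shattered : Shattered G x) where

    x-injective : Injective _≡_ _≡_ x
    x-injective = proj₁ shattered

    TraceIs : Fin n → (Fin d → Set) → Set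
    TraceIs z P = ∀ i → InClosedNbhd G z (x i) ⇔ P i

    realise : (P : Fin d → Set) → Decidable P → ∃[ z ] TraceIs z P
    realise P P? with proj₂ shattered (isYes ∘ P?)
    ... | z , trace = z , λ i → ⇔.trans (trace i) (mk⇔ (toWitness ∘ from T-≡) (to T-≡ ∘ fromWitness))

    trace-Adj : ∀ {z P i} → TraceIs z P → inK z ≢ inK (x i) → P i → Adj G z (x i)
    trace-Adj trace sides p = closedNbhd⇒Adj sides (from (trace _) p)

    trace-nonAdj : ∀ {z P i} → TraceIs z P → ¬ P i → ¬ Adj G z (x i)
    trace-nonAdj trace ¬p zx = ¬p (to (trace _) (inj₂ zx))

    Pair : Fin d → Fin d → Fin d → Set
    Pair s t i = i ≡ s ⊎ i ≡ t

    realisePair : ∀ s t → ∃[ z ] TraceIs z (Pair s t)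
    realisePair s t = realise (Pair s t) (λ i → (i ≟ s) ⊎-dec (i ≟ t))

    pairTrace-S⇒K : ∀ {z s t} → s ≢ t → inK (x s) ≡ false → inK (x t) ≡ false →
                    TraceIs z (Pair s t) → inK z ≡ true
    pairTrace-S⇒K s≢t s∈S t∈S trace =
      closedNbhd-two-S⇒K (s≢t ∘ x-injective) s∈S t∈S (from (trace _) (inj₁ refl)) (from (trace _) (inj₂ refl))

    stable-points-coincide : ∀ {k s t} → inK (x k) ≡ true → inK (x s) ≡ false → inK (x t) ≡ false → s ≡ t
    stable-points-coincide {k} {s} {t} k∈K s∈S t∈S with s ≟ t | realisePair s t
    ... | yes s≡t | _ = s≡t
    ... | no s≢t | z , trace =
      contradiction (to (trace k) (K-closedNbhd (pairTrace-S⇒K s≢t s∈S t∈S trace) k∈K))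
        [ S≢K s∈S k∈K ∘ ≡-sym ∘ cong (inK ∘ x) , S≢K t∈S k∈K ∘ ≡-sym ∘ cong (inK ∘ x) ]

    three-K⇒pendantTriangle : (ι : Fin 3 → Fin d) → Injective _≡_ _≡_ ι →
                              (∀ i → inK (x (ι i)) ≡ true) → PendantTriangle G
    three-K⇒pendantTriangle ι ι-injective ι∈K = record
      { apex            = x ∘ ι
      ; pendant         = z
      ; apex-adj        = λ i≢j → K-clique _ _ (i≢j ∘ ι-injective ∘ x-injective) (ι∈K _) (ι∈K _)
      ; pendant-nonadj  = λ i j → S-stable _ _ (z∈S i) (z∈S j)
      ; apex-pendant    = λ i → sym G (trace-Adj (trace i) (S≢K (z∈S i) (ι∈K i)) refl)
      ; apex-nonpendant = λ i≢j → trace-nonAdj (trace _) (i≢j ∘ ι-injective) ∘ sym G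
      }
      where
      cut : ∀ i → ∃[ z ] TraceIs z (_≡ ι i)
      cut i = realise (_≡ ι i) (_≟ ι i)

      z : Fin 3 → Fin n
      z = proj₁ ∘ cut

      trace : ∀ i → TraceIs (z i) (_≡ ι i)
      trace = proj₂ ∘ cut

      z∈S : ∀ i → inK (z i) ≡ false
      z∈S i = closedNbhd-missing-K⇒S (ι∈K j) (punchInᵢ≢i i 0F ∘ ι-injective ∘ to (trace i (ι j)))
        where j = punchIn i 0F

    four-S⇒pendantTriangle : (ι : Fin 4 → Fin d) → Injective _≡_ _≡_ ι →
                             (∀ i → inK (x (ι i)) ≡ false) → PendantTriangle G
    four-S⇒pendantTriangle ι ι-injective ι∈S = record
      { apex            = z
      ; pendant         = x ∘ a
      ; apex-adj        = λ i≢j → K-clique _ _ (z-distinct i≢j) (z∈K _) (z∈K _)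
      ; pendant-nonadj  = λ i j → S-stable _ _ (ι∈S _) (ι∈S _)
      ; apex-pendant    = λ i → trace-Adj (trace i) (≢-sym (S≢K (ι∈S _) (z∈K i))) (inj₁ refl)
      ; apex-nonpendant = λ i≢j → trace-nonAdj (trace _) (outside-trace i≢j)
      }
      where
      a : Fin 3 → Fin d
      a = ι ∘ punchIn 3F

      e : Fin d
      e = ι 3F

      a≢e : ∀ i → a i ≢ e
      a≢e i = punchInᵢ≢i 3F i ∘ ι-injective

      outside-trace : ∀ {i j} → i ≢ j → ¬ Pair (a i) e (a j)
      outside-trace i≢j = [ ≢-sym i≢j ∘ punchIn-injective 3F _ _ ∘ ι-injective , a≢e _ ]

      cut : ∀ i → ∃[ z ] TraceIs z (Pair (a i) e)
      cut i = realisePair (a i) e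

      z : Fin 3 → Fin n
      z = proj₁ ∘ cut

      trace : ∀ i → TraceIs (z i) (Pair (a i) e)
      trace = proj₂ ∘ cut

      z∈K : ∀ i → inK (z i) ≡ true
      z∈K i = pairTrace-S⇒K (a≢e i) (ι∈S _) (ι∈S 3F) (trace i)

      z-distinct : ∀ {i j} → i ≢ j → z i ≢ z j
      z-distinct {i} {j} i≢j zi≡zj = outside-trace (≢-sym i≢j)
        (to (trace j (a i)) (subst (λ w → InClosedNbhd G w (x (a i))) zi≡zj (from (trace i (a i)) (inj₁ refl))))

    no-shattered-four : B₁Free G → (ι : Fin 4 → Fin d) → Injective _≡_ _≡_ ι → ⊥
    no-shattered-four free ι ι-injective with all? (λ i → inK (x (ι i)) ≟ᵇ false)
    ... | yes all-S = free (pendantTriangle⇒B₁ (four-S⇒pendantTriangle ι ι-injective all-S))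
    ... | no not-all-S with ¬∀⟶∃¬ 4 _ (λ i → inK (x (ι i)) ≟ᵇ false) not-all-S
    ...   | k₀ , k₀∉S with atMostOneFalse⇒allTrueExcept (inK ∘ x ∘ ι)
                             (λ s∈S t∈S → ι-injective (stable-points-coincide (¬-not k₀∉S) s∈S t∈S))
    ...     | k , others∈K = free (pendantTriangle⇒B₁ (three-K⇒pendantTriangle (ι ∘ punchIn k)
                               (punchIn-injective k _ _ ∘ ι-injective) (λ i → others∈K _ (punchInᵢ≢i k i))))

lemma11 : ∀ (n : ℕ) (G : Graph n) → IsSplit G → B₁Free G → VCDimAtMost G 3
lemma11 n G (inK , K-clique , S-stable) free d x shattered with d ≤? 3
... | yes d≤3 = d≤3
... | no d≰3 = ⊥-elim (no-shattered-four free (λ i → inject≤ i 4≤d) (inject≤-injective 4≤d 4≤d _ _))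
  where
  open SplitGraph G inK K-clique S-stable
  open Shattering shattered

  4≤d : 4 ℕ.≤ d
  4≤d = ≰⇒> d≰3
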